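{- Let $n$ be a non-negative integer and let $s_n(x)=\sum_{k=0}^n\binom{n}{k}\binom{x}{k}\binom{x+k}{k}$. Then $$s_n(x)^2=\sum_{k=0}^{n}\binom{n+k}{2k}\binom{x}{k}\binom{x+k}{k}\sum_{j=0}^{k}\binom{2k}{j+k}\binom{x}{j}\binom{x+j}{j}.$$
   Context: Here $\binom{x}{k}=x(x-1)\cdots(x-k+1)/k!$, and the identity is an identity of polynomials in $x$. -}

module Defs where

open import Data.Nat using (ℕ; zero; suc; _!)
open import Data.Nat.Properties using (_!≢0)
open import Data.Nat.Combinatorics using (_C_)
open import Data.Integer using (+_)
open import Data.Rational using (ℚ; _/_; _+_; _-_; _*_; 0ℚ; 1ℚ)

ℕ→ℚ : ℕ → ℚ
ℕ→ℚ n = + n / 1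

falling : ℚ → ℕ → ℚ
falling x zero = 1ℚ
falling x (suc k) = falling x k * (x - ℕ→ℚ k)

binom : ℚ → ℕ → ℚ
binom x k = falling x k * ((+ 1 / (k !)) {{k !≢0}})

choose : ℕ → ℕ → ℚ
choose n k = ℕ→ℚ (n C k)

sumTo : ℕ → (ℕ → ℚ) → ℚ
sumTo zero f = f zero
sumTo (suc n) f = sumTo n f + f (suc n)

s : ℕ → ℚ → ℚ
s n x = sumTo n (λ k → choose n k * binom x k * binom (x + ℕ→ℚ k) k)

{-# OPTIONS --safe #-}
-- Write F k = C(x,k) C(x+k,k) (basis x k below).  From (k+1)² F (k+1) = (y − k(k+1)) F k with
-- y = x(x+1), induction on i gives the linearization F i · F j = Σ_l C(l,i) C(l,j) C(i+j,l) F l,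
-- so both sides of the identity expand in the F l with natural-number coefficients.  Vandermonde
-- convolution and trinomial revision turn the coefficient of F l into Σ_t F t(n) F (l−t)(n) on the
-- left and Σ_k C(l,k) C(2k,l) F k(n) on the right.  These agree because
-- Σ_t F t · F (l−t) = Σ_k C(l,k) C(2k,l) F k is itself a consequence of the linearization,
-- here evaluated at x = n.
module Submission where

open import Algebra.Bundles using (CommutativeSemiring)
open import Data.Nat.Base as ℕ using (ℕ; zero; suc; _≤_; _<_; _∸_; z≤n)
import Data.Nat.Properties as ℕ
open import Data.Sum.Base using (inj₁; inj₂)
open import Relation.Binary.PropositionalEquality.Core as ≡ using (_≡_; _≢_)
open import Relation.Nullary.Decidable.Core using (yes; no)
open import Function.Base using (_∘_)

-- Finite sums

module RangeSum {c ℓ} (R : CommutativeSemiring c ℓ) where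

  open CommutativeSemiring R
  open import Algebra.Properties.CommutativeSemigroup +-commutativeSemigroup
    using (interchange)
  open import Relation.Binary.Reasoning.Setoid setoid

  -- ∑ n f sums f k over k < n, whereas Defs.sumTo n f also includes f n.
  ∑ : ℕ → (ℕ → Carrier) → Carrier
  ∑ zero    f = 0#
  ∑ (suc n) f = ∑ n f + f n

  ∑-cong : ∀ n {f g : ℕ → Carrier} → (∀ {k} → k < n → f k ≈ g k) → ∑ n f ≈ ∑ n g
  ∑-cong zero    f≈g = refl
  ∑-cong (suc n) f≈g = +-cong (∑-cong n (λ k<n → f≈g (ℕ.m<n⇒m<1+n k<n))) (f≈g ℕ.≤-refl)

  ∑-cong′ : ∀ n {f g : ℕ → Carrier} → (∀ k → f k ≈ g k) → ∑ n f ≈ ∑ n g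
  ∑-cong′ n f≈g = ∑-cong n (λ {k} _ → f≈g k)

  ∑-zero : ∀ n {f : ℕ → Carrier} → (∀ {k} → k < n → f k ≈ 0#) → ∑ n f ≈ 0#
  ∑-zero zero    f≈0 = refl
  ∑-zero (suc n) f≈0 = trans (+-cong (∑-zero n (λ k<n → f≈0 (ℕ.m<n⇒m<1+n k<n))) (f≈0 ℕ.≤-refl)) (+-identityʳ 0#)

  ∑-+ : ∀ n (f g : ℕ → Carrier) → ∑ n (λ k → f k + g k) ≈ ∑ n f + ∑ n g
  ∑-+ zero    f g = sym (+-identityʳ 0#)
  ∑-+ (suc n) f g = trans (+-congʳ (∑-+ n f g)) (interchange _ _ _ _)

  *-distribˡ-∑ : ∀ n a (f : ℕ → Carrier) → a * ∑ n f ≈ ∑ n (λ k → a * f k)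
  *-distribˡ-∑ zero    a f = zeroʳ a
  *-distribˡ-∑ (suc n) a f = trans (distribˡ a (∑ n f) (f n)) (+-congʳ (*-distribˡ-∑ n a f))

  *-distribʳ-∑ : ∀ n a (f : ℕ → Carrier) → ∑ n f * a ≈ ∑ n (λ k → f k * a)
  *-distribʳ-∑ n a f = trans (*-comm (∑ n f) a) (trans (*-distribˡ-∑ n a f) (∑-cong′ n (λ k → *-comm a (f k))))

  ∑-*-∑ : ∀ m n (f g : ℕ → Carrier) → ∑ m f * ∑ n g ≈ ∑ m (λ i → ∑ n (λ j → f i * g j))
  ∑-*-∑ m n f g = trans (*-distribʳ-∑ m (∑ n g) f) (∑-cong′ m (λ i → *-distribˡ-∑ n (f i) g))

  ∑-suc : ∀ n (f : ℕ → Carrier) → ∑ (suc n) f ≈ f 0 + ∑ n (λ k → f (suc k))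
  ∑-suc zero    f = trans (+-identityˡ (f 0)) (sym (+-identityʳ (f 0)))
  ∑-suc (suc n) f = trans (+-congʳ (∑-suc n f)) (+-assoc (f 0) _ _)

  ∑-+-shift : ∀ n (f g : ℕ → Carrier) → f n ≈ 0# →
              ∑ n (λ l → f l + g l) ≈ f 0 + ∑ n (λ l → f (suc l) + g l)
  ∑-+-shift n f g fₙ≈0 = begin
    ∑ n (λ l → f l + g l)                       ≈⟨ ∑-+ n f g ⟩
    ∑ n f + ∑ n g                               ≈⟨ +-congʳ (+-identityʳ (∑ n f)) ⟨
    (∑ n f + 0#) + ∑ n g                        ≈⟨ +-congʳ (+-congˡ fₙ≈0) ⟨
    ∑ (suc n) f + ∑ n g                         ≈⟨ +-congʳ (∑-suc n f) ⟩
    (f 0 + ∑ n (λ l → f (suc l))) + ∑ n g       ≈⟨ +-assoc (f 0) _ _ ⟩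
    f 0 + (∑ n (λ l → f (suc l)) + ∑ n g)       ≈⟨ +-congˡ (∑-+ n (λ l → f (suc l)) g) ⟨
    f 0 + ∑ n (λ l → f (suc l) + g l)           ∎

  ∑-comm : ∀ m n (f : ℕ → ℕ → Carrier) →
           ∑ m (λ i → ∑ n (λ j → f i j)) ≈ ∑ n (λ j → ∑ m (λ i → f i j))
  ∑-comm zero    n f = sym (∑-zero n (λ _ → refl))
  ∑-comm (suc m) n f = trans (+-congʳ (∑-comm m n f)) (sym (∑-+ n _ _))

  ∑-extend : ∀ {m n} (f : ℕ → Carrier) → m ≤ n → (∀ {k} → m ≤ k → f k ≈ 0#) → ∑ n f ≈ ∑ m f
  ∑-extend {n = zero}  f z≤n     f≈0 = refl
  ∑-extend {n = suc n} f m≤1+n f≈0 with ℕ.m≤n⇒m<n∨m≡n m≤1+n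
  ... | inj₁ m<1+n = trans (+-cong (∑-extend f (ℕ.≤-pred m<1+n) f≈0) (f≈0 (ℕ.≤-pred m<1+n))) (+-identityʳ _)
  ... | inj₂ ≡.refl = refl

  ∑-rebound : ∀ m n (f : ℕ → Carrier) → (∀ {k} → m ≤ k → f k ≈ 0#) → (∀ {k} → n ≤ k → f k ≈ 0#) →
              ∑ m f ≈ ∑ n f
  ∑-rebound m n f fₘ≈0 fₙ≈0 with ℕ.≤-total m n
  ... | inj₁ m≤n = sym (∑-extend f m≤n fₘ≈0)
  ... | inj₂ n≤m = ∑-extend f n≤m fₙ≈0

  ∑-δ : ∀ {a n} (f : ℕ → Carrier) → a < n → (∀ {k} → k ≢ a → f k ≈ 0#) → ∑ n f ≈ f a
  ∑-δ {a} {suc n} f a<1+n f≈0 with a ℕ.≟ n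
  ... | yes ≡.refl = trans (+-congʳ (∑-zero n (λ k<a → f≈0 (ℕ.<⇒≢ k<a)))) (+-identityˡ (f a))
  ... | no  a≢n    = trans (+-cong (∑-δ f (ℕ.≤∧≢⇒< (ℕ.≤-pred a<1+n) a≢n) f≈0) (f≈0 (a≢n ∘ ≡.sym))) (+-identityʳ (f a))

module ℕ∑ = RangeSum ℕ.+-*-commutativeSemiring

-- Binomial identities over ℕ

module _ where

  open import Data.Nat.Base using (_+_; _*_; _!; z<s)
  open import Data.Product.Base using (_,_)
  open import Relation.Nullary.Negation.Core using (contradiction)
  open import Relation.Binary.Definitions using (tri<; tri≈; tri>)
  open import Data.Nat.Properties
  open import Data.Nat.Combinatorics
    using (_C_; nCk≡n!/k![n-k]!; k![n∸k]!∣n!; nCk≡nC[n∸k]; k>n⇒nCk≡0; nC1≡n; nCn≡1; nCk+nC[k+1]≡[n+1]C[k+1])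
  open import Data.Nat.DivMod using (_/_; m/n*n≡m)
  open import Data.Nat.Tactic.RingSolver using (solve-∀)
  open import Relation.Binary.PropositionalEquality
  open ≡-Reasoning
  open ℕ∑
  open import Algebra.Properties.CommutativeSemigroup *-commutativeSemigroup using (x∙yz≈y∙xz)

  C-factorial : ∀ a b → ((a + b) C a) * (a ! * b !) ≡ (a + b) !
  C-factorial a b = begin
    ((a + b) C a) * (a ! * b !)                                 ≡⟨ cong (λ m → ((a + b) C a) * (a ! * m !)) (m+n∸m≡n a b) ⟨
    ((a + b) C a) * (a ! * ((a + b) ∸ a) !)                     ≡⟨ cong (_* (a ! * ((a + b) ∸ a) !)) (nCk≡n!/k![n-k]! a≤a+b) ⟩
    ((a + b) ! / (a ! * ((a + b) ∸ a) !)) * (a ! * ((a + b) ∸ a) !) ≡⟨ m/n*n≡m (k![n∸k]!∣n! a≤a+b) ⟩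
    (a + b) !                                                   ∎
    where
    a≤a+b = m≤m+n a b
    instance _ = a !* ((a + b) ∸ a) !≢0

  C-revision⁺ : ∀ k p q → (((k + p) + q) C (k + p)) * ((k + p) C k) ≡ (((k + p) + q) C k) * ((p + q) C p)
  C-revision⁺ k p q = *-cancelʳ-≡ _ _ (k ! * p ! * q !) {{k!p!q!≢0}} (begin
    (N C (k + p)) * ((k + p) C k) * (k ! * p ! * q !)     ≡⟨ shuffle₁ (N C (k + p)) ((k + p) C k) (k !) (p !) (q !) ⟩
    (N C (k + p)) * (((k + p) C k) * (k ! * p !) * q !)   ≡⟨ cong (λ m → (N C (k + p)) * (m * q !)) (C-factorial k p) ⟩
    (N C (k + p)) * ((k + p) ! * q !)                     ≡⟨ C-factorial (k + p) q ⟩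
    N !                                                   ≡⟨ cong _! (+-assoc k p q) ⟩
    (k + (p + q)) !                                       ≡⟨ C-factorial k (p + q) ⟨
    ((k + (p + q)) C k) * (k ! * (p + q) !)               ≡⟨ cong₂ (λ n m → (n C k) * (k ! * m)) (+-assoc k p q) (C-factorial p q) ⟨
    (N C k) * (k ! * (((p + q) C p) * (p ! * q !)))       ≡⟨ shuffle₂ (N C k) ((p + q) C p) (k !) (p !) (q !) ⟩
    (N C k) * ((p + q) C p) * (k ! * p ! * q !)           ∎)
    where
    N = (k + p) + q
    k!p!q!≢0 = m*n≢0 (k ! * p !) (q !) {{k !* p !≢0}} {{q !≢0}}
    shuffle₁ : ∀ a b x y z → a * b * (x * y * z) ≡ a * (b * (x * y) * z)
    shuffle₁ = solve-∀
    shuffle₂ : ∀ a b x y z → a * (x * (b * (y * z))) ≡ a * b * (x * y * z)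
    shuffle₂ = solve-∀

  C-sym⁺ : ∀ a b → (a + b) C a ≡ (a + b) C b
  C-sym⁺ a b = trans (nCk≡nC[n∸k] (m≤m+n a b)) (cong ((a + b) C_) (m+n∸m≡n a b))

  -- With truncated subtraction this holds for every n: if n < m both sides vanish.
  C-revision : ∀ n {m k} → k ≤ m → (n C m) * (m C k) ≡ (n C k) * ((n ∸ k) C (m ∸ k))
  C-revision n {m} {k} k≤m with m ≤? n
  ... | no m≰n = begin
    (n C m) * (m C k)                ≡⟨ cong (_* (m C k)) (k>n⇒nCk≡0 (≰⇒> m≰n)) ⟩
    0                                ≡⟨ vanishing ⟨
    (n C k) * ((n ∸ k) C (m ∸ k))    ∎
    where
    vanishing : (n C k) * ((n ∸ k) C (m ∸ k)) ≡ 0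
    vanishing with k ≤? n
    ... | yes k≤n = trans (cong ((n C k) *_) (k>n⇒nCk≡0 (∸-monoˡ-< (≰⇒> m≰n) k≤n))) (*-zeroʳ (n C k))
    ... | no k≰n  = cong (_* ((n ∸ k) C (m ∸ k))) (k>n⇒nCk≡0 (≰⇒> k≰n))
  ... | yes m≤n with m≤n⇒∃[o]m+o≡n k≤m | m≤n⇒∃[o]m+o≡n m≤n
  ...   | p , refl | q , refl = begin
    (((k + p) + q) C (k + p)) * ((k + p) C k)
      ≡⟨ C-revision⁺ k p q ⟩
    (((k + p) + q) C k) * ((p + q) C p)
      ≡⟨ cong₂ (λ a b → (((k + p) + q) C k) * (a C b)) N∸k≡p+q (m+n∸m≡n k p) ⟨
    (((k + p) + q) C k) * ((((k + p) + q) ∸ k) C ((k + p) ∸ k))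
      ∎
    where
    N∸k≡p+q : ((k + p) + q) ∸ k ≡ p + q
    N∸k≡p+q = trans (cong (_∸ k) (+-assoc k p q)) (m+n∸m≡n k (p + q))

  C-revision-complement : ∀ {l i} t → i ≤ l → (l C i) * (i C t) ≡ (l C t) * ((l ∸ t) C (l ∸ i))
  C-revision-complement {l} {i} t i≤l with t ≤? i
  ... | yes t≤i = begin
    (l C i) * (i C t)                          ≡⟨ C-revision l t≤i ⟩
    (l C t) * ((l ∸ t) C (i ∸ t))              ≡⟨ cong ((l C t) *_) (nCk≡nC[n∸k] (∸-monoˡ-≤ t i≤l)) ⟩
    (l C t) * ((l ∸ t) C ((l ∸ t) ∸ (i ∸ t)))  ≡⟨ cong (λ m → (l C t) * ((l ∸ t) C m)) [l∸t]∸[i∸t]≡l∸i ⟩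
    (l C t) * ((l ∸ t) C (l ∸ i))              ∎
    where
    [l∸t]∸[i∸t]≡l∸i : (l ∸ t) ∸ (i ∸ t) ≡ l ∸ i
    [l∸t]∸[i∸t]≡l∸i = trans (∸-+-assoc l t (i ∸ t)) (cong (l ∸_) (m+[n∸m]≡n t≤i))
  ... | no t≰i = begin
    (l C i) * (i C t)              ≡⟨ cong ((l C i) *_) (k>n⇒nCk≡0 (≰⇒> t≰i)) ⟩
    (l C i) * 0                    ≡⟨ *-zeroʳ (l C i) ⟩
    0                              ≡⟨ vanishing ⟨
    (l C t) * ((l ∸ t) C (l ∸ i))  ∎
    where
    vanishing : (l C t) * ((l ∸ t) C (l ∸ i)) ≡ 0
    vanishing with t ≤? l
    ... | yes t≤l = trans (cong ((l C t) *_) (k>n⇒nCk≡0 (∸-monoʳ-< (≰⇒> t≰i) t≤l))) (*-zeroʳ (l C t))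
    ... | no t≰l  = cong (_* ((l ∸ t) C (l ∸ i))) (k>n⇒nCk≡0 (≰⇒> t≰l))

  -- (k+1) C(n,k+1) = (n−k) C(n,k), stated without subtraction.
  C-absorption : ∀ n k → (n C suc k) * suc k + (n C k) * k ≡ (n C k) * n
  C-absorption n k with k ≤? n
  ... | yes k≤n = begin
    (n C suc k) * suc k + (n C k) * k          ≡⟨ cong (λ m → (n C suc k) * m + (n C k) * k) [1+k]Ck≡1+k ⟨
    (n C suc k) * (suc k C k) + (n C k) * k    ≡⟨ cong (_+ (n C k) * k) (C-revision n (n≤1+n k)) ⟩
    (n C k) * ((n ∸ k) C (suc k ∸ k)) + (n C k) * k ≡⟨ cong (λ m → (n C k) * ((n ∸ k) C m) + (n C k) * k) (m+n∸n≡m 1 k) ⟩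
    (n C k) * ((n ∸ k) C 1) + (n C k) * k      ≡⟨ cong (λ m → (n C k) * m + (n C k) * k) (nC1≡n (n ∸ k)) ⟩
    (n C k) * (n ∸ k) + (n C k) * k            ≡⟨ *-distribˡ-+ (n C k) (n ∸ k) k ⟨
    (n C k) * (n ∸ k + k)                      ≡⟨ cong ((n C k) *_) (m∸n+n≡m k≤n) ⟩
    (n C k) * n                                ∎
    where
    [1+k]Ck≡1+k : suc k C k ≡ suc k
    [1+k]Ck≡1+k = trans (nCk≡nC[n∸k] (n≤1+n k)) (trans (cong (suc k C_) (m+n∸n≡m 1 k)) (nC1≡n (suc k)))
  ... | no k≰n
    rewrite k>n⇒nCk≡0 (≰⇒> k≰n) | k>n⇒nCk≡0 (m<n⇒m<1+n (≰⇒> k≰n)) = refl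

  vandermonde : ∀ a b m → ∑ (suc m) (λ t → (a C t) * (b C (m ∸ t))) ≡ (a + b) C m
  vandermonde zero    b m       = trans (∑-δ {n = suc m} _ z<s 0Ct≡0) (+-identityʳ (b C m))
    where
    0Ct≡0 : ∀ {t} → t ≢ 0 → (0 C t) * (b C (m ∸ t)) ≡ 0
    0Ct≡0 {zero}  t≢0 = contradiction refl t≢0
    0Ct≡0 {suc t} _   = refl
  vandermonde (suc a) b zero    = refl
  vandermonde (suc a) b (suc m) = begin
    ∑ (suc (suc m)) (λ t → (suc a C t) * (b C (suc m ∸ t)))
      ≡⟨ ∑-suc (suc m) _ ⟩
    (suc a C 0) * (b C suc m) + ∑ (suc m) (λ t → (suc a C suc t) * (b C (m ∸ t)))
      ≡⟨ cong ((suc a C 0) * (b C suc m) +_) (∑-cong′ (suc m) pascal) ⟩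
    (suc a C 0) * (b C suc m) + ∑ (suc m) (λ t → (a C t) * (b C (m ∸ t)) + (a C suc t) * (b C (m ∸ t)))
      ≡⟨ cong ((suc a C 0) * (b C suc m) +_) (∑-+ (suc m) _ _) ⟩
    (suc a C 0) * (b C suc m) + (∑ (suc m) (λ t → (a C t) * (b C (m ∸ t))) + ∑ (suc m) (λ t → (a C suc t) * (b C (m ∸ t))))
      ≡⟨ shuffle ((suc a C 0) * (b C suc m)) _ _ ⟩
    ((a C 0) * (b C suc m) + ∑ (suc m) (λ t → (a C suc t) * (b C (m ∸ t)))) + ∑ (suc m) (λ t → (a C t) * (b C (m ∸ t)))
      ≡⟨ cong (_+ ∑ (suc m) (λ t → (a C t) * (b C (m ∸ t)))) (∑-suc (suc m) _) ⟨
    ∑ (suc (suc m)) (λ t → (a C t) * (b C (suc m ∸ t))) + ∑ (suc m) (λ t → (a C t) * (b C (m ∸ t)))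
      ≡⟨ cong₂ _+_ (vandermonde a b (suc m)) (vandermonde a b m) ⟩
    ((a + b) C suc m) + ((a + b) C m)
      ≡⟨ +-comm ((a + b) C suc m) _ ⟩
    ((a + b) C m) + ((a + b) C suc m)
      ≡⟨ nCk+nC[k+1]≡[n+1]C[k+1] (a + b) m ⟩
    (suc a + b) C suc m ∎
    where
    pascal : ∀ t → (suc a C suc t) * (b C (m ∸ t)) ≡ (a C t) * (b C (m ∸ t)) + (a C suc t) * (b C (m ∸ t))
    pascal t = trans (cong (_* (b C (m ∸ t))) (sym (nCk+nC[k+1]≡[n+1]C[k+1] a t)))
                     (*-distribʳ-+ (b C (m ∸ t)) (a C t) (a C suc t))
    shuffle : ∀ x y z → x + (y + z) ≡ (x + z) + y
    shuffle = solve-∀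

  linCoeff : ℕ → ℕ → ℕ → ℕ
  linCoeff i j l = (l C i) * (l C j) * ((i + j) C l)

  linCoeff-vanishes : ∀ {i j l} → i + j < l → linCoeff i j l ≡ 0
  linCoeff-vanishes {i} {j} {l} i+j<l =
    trans (cong ((l C i) * (l C j) *_) (k>n⇒nCk≡0 i+j<l)) (*-zeroʳ ((l C i) * (l C j)))

  linCoeff-diagonal₀ : ∀ j → linCoeff 0 j j ≡ 1
  linCoeff-diagonal₀ j rewrite nCn≡1 j = refl

  linCoeff-off-diagonal₀ : ∀ {j l} → l ≢ j → linCoeff 0 j l ≡ 0
  linCoeff-off-diagonal₀ {j} {l} l≢j with <-cmp l j
  ... | tri< l<j _ _ = cong (λ a → (l C 0) * a * (j C l)) (k>n⇒nCk≡0 l<j)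
  ... | tri≈ _ l≡j _ = contradiction l≡j l≢j
  ... | tri> _ _ j<l = linCoeff-vanishes {0} {j} j<l

  basisℕ : ℕ → ℕ → ℕ
  basisℕ n k = (n C k) * ((n + k) C k)

  basisℕ-revision : ∀ n k → basisℕ n k ≡ ((n + k) C (k + k)) * ((k + k) C k)
  basisℕ-revision n k = sym (begin
    ((n + k) C (k + k)) * ((k + k) C k)
      ≡⟨ C-revision (n + k) (m≤m+n k k) ⟩
    ((n + k) C k) * (((n + k) ∸ k) C ((k + k) ∸ k))
      ≡⟨ cong₂ (λ a b → ((n + k) C k) * (a C b)) (m+n∸n≡m n k) (m+n∸m≡n k k) ⟩
    ((n + k) C k) * (n C k)
      ≡⟨ *-comm ((n + k) C k) (n C k) ⟩
    basisℕ n k ∎)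

  ∑-triple-choose : ∀ n l t → t ≤ l →
    ∑ (suc n) (λ i → (n C i) * (l C i) * (i C t)) ≡ (l C t) * ((n + (l ∸ t)) C l)
  ∑-triple-choose n l t t≤l = begin
    ∑ (suc n) g                                                ≡⟨ ∑-rebound (suc n) (suc l) g beyond-n beyond-l ⟩
    ∑ (suc l) g                                                ≡⟨ ∑-cong (suc l) (λ i<1+l → revise (≤-pred i<1+l)) ⟩
    ∑ (suc l) (λ i → (l C t) * ((n C i) * ((l ∸ t) C (l ∸ i)))) ≡⟨ *-distribˡ-∑ (suc l) (l C t) _ ⟨
    (l C t) * ∑ (suc l) (λ i → (n C i) * ((l ∸ t) C (l ∸ i)))  ≡⟨ cong ((l C t) *_) (vandermonde n (l ∸ t) l) ⟩
    (l C t) * ((n + (l ∸ t)) C l)                              ∎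
    where
    g : ℕ → ℕ
    g i = (n C i) * (l C i) * (i C t)
    beyond-n : ∀ {i} → suc n ≤ i → g i ≡ 0
    beyond-n {i} n<i = cong (λ a → a * (l C i) * (i C t)) (k>n⇒nCk≡0 n<i)
    beyond-l : ∀ {i} → suc l ≤ i → g i ≡ 0
    beyond-l {i} l<i = trans (cong (λ a → (n C i) * a * (i C t)) (k>n⇒nCk≡0 l<i))
                             (cong (_* (i C t)) (*-zeroʳ (n C i)))
    revise : ∀ {i} → i ≤ l → g i ≡ (l C t) * ((n C i) * ((l ∸ t) C (l ∸ i)))
    revise {i} i≤l = begin
      (n C i) * (l C i) * (i C t)                    ≡⟨ *-assoc (n C i) (l C i) (i C t) ⟩
      (n C i) * ((l C i) * (i C t))                  ≡⟨ cong ((n C i) *_) (C-revision-complement t i≤l) ⟩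
      (n C i) * ((l C t) * ((l ∸ t) C (l ∸ i)))      ≡⟨ x∙yz≈y∙xz (n C i) (l C t) _ ⟩
      (l C t) * ((n C i) * ((l ∸ t) C (l ∸ i)))      ∎

  ∑-triple-choose-product : ∀ n l t → t ≤ l →
    ∑ (suc n) (λ i → (n C i) * (l C i) * (i C t)) * ∑ (suc n) (λ j → (n C j) * (l C j) * (j C (l ∸ t)))
      ≡ basisℕ n t * basisℕ n (l ∸ t)
  ∑-triple-choose-product n l t t≤l = begin
    ∑ (suc n) (λ i → (n C i) * (l C i) * (i C t)) * ∑ (suc n) (λ j → (n C j) * (l C j) * (j C u))
      ≡⟨ cong₂ _*_ (∑-triple-choose n l t t≤l) (∑-triple-choose n l u (m∸n≤m l t)) ⟩
    ((l C t) * ((n + u) C l)) * ((l C u) * ((n + (l ∸ u)) C l))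
      ≡⟨ cong (λ a → ((l C t) * ((n + u) C l)) * ((l C u) * ((n + a) C l))) l∸u≡t ⟩
    ((l C t) * ((n + u) C l)) * ((l C u) * ((n + t) C l))
      ≡⟨ swap (l C t) ((n + u) C l) (l C u) ((n + t) C l) ⟩
    ((l C t) * ((n + t) C l)) * ((l C u) * ((n + u) C l))
      ≡⟨ cong₂ _*_ (revise t≤l) (revise (m∸n≤m l t)) ⟩
    (((n + t) C t) * (n C (l ∸ t))) * (((n + u) C u) * (n C (l ∸ u)))
      ≡⟨ cong (λ a → (((n + t) C t) * (n C u)) * (((n + u) C u) * (n C a))) l∸u≡t ⟩
    (((n + t) C t) * (n C u)) * (((n + u) C u) * (n C t))
      ≡⟨ regroup ((n + t) C t) (n C u) ((n + u) C u) (n C t) ⟩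
    basisℕ n t * basisℕ n u
      ∎
    where
    u = l ∸ t
    l∸u≡t : l ∸ u ≡ t
    l∸u≡t = m∸[m∸n]≡n t≤l
    revise : ∀ {v} → v ≤ l → (l C v) * ((n + v) C l) ≡ ((n + v) C v) * (n C (l ∸ v))
    revise {v} v≤l = begin
      (l C v) * ((n + v) C l)                     ≡⟨ *-comm (l C v) _ ⟩
      ((n + v) C l) * (l C v)                     ≡⟨ C-revision (n + v) v≤l ⟩
      ((n + v) C v) * (((n + v) ∸ v) C (l ∸ v))   ≡⟨ cong (λ a → ((n + v) C v) * (a C (l ∸ v))) (m+n∸n≡m n v) ⟩
      ((n + v) C v) * (n C (l ∸ v))               ∎
    swap : ∀ a b c d → (a * b) * (c * d) ≡ (a * d) * (c * b)
    swap = solve-∀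
    regroup : ∀ a b c d → (a * b) * (c * d) ≡ (d * a) * (b * c)
    regroup = solve-∀

  ∑-linCoeff-antidiagonal : ∀ l k → ∑ (suc l) (λ t → linCoeff t (l ∸ t) k) ≡ (l C k) * ((k + k) C l)
  ∑-linCoeff-antidiagonal l k = begin
    ∑ (suc l) (λ t → linCoeff t (l ∸ t) k)
      ≡⟨ ∑-cong (suc l) (λ {t} t<1+l → cong (λ a → (k C t) * (k C (l ∸ t)) * (a C k)) (m+[n∸m]≡n (≤-pred t<1+l))) ⟩
    ∑ (suc l) (λ t → (k C t) * (k C (l ∸ t)) * (l C k))
      ≡⟨ *-distribʳ-∑ (suc l) (l C k) _ ⟨
    ∑ (suc l) (λ t → (k C t) * (k C (l ∸ t))) * (l C k)
      ≡⟨ cong (_* (l C k)) (vandermonde k k l) ⟩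
    ((k + k) C l) * (l C k)
      ≡⟨ *-comm ((k + k) C l) (l C k) ⟩
    (l C k) * ((k + k) C l)
      ∎

  linCoeff-upper-term : ∀ k l {j} → j ≤ l →
    ((k + k) C (j + k)) * linCoeff k j l ≡ ((l C k) * ((k + k) C k)) * ((k C j) * (k C (l ∸ j)))
  linCoeff-upper-term k l {j} j≤l = begin
    ((k + k) C (j + k)) * ((l C k) * (l C j) * ((k + j) C l))
      ≡⟨ shuffle₁ ((k + k) C (j + k)) (l C k) (l C j) ((k + j) C l) ⟩
    (l C k) * (((k + k) C (j + k)) * (((k + j) C l) * (l C j)))
      ≡⟨ cong (λ a → (l C k) * (((k + k) C (j + k)) * a)) (C-revision (k + j) j≤l) ⟩
    (l C k) * (((k + k) C (j + k)) * (((k + j) C j) * (((k + j) ∸ j) C (l ∸ j))))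
      ≡⟨ cong₂ (λ a b → (l C k) * (((k + k) C (j + k)) * (a * (b C (l ∸ j))))) [k+j]Cj≡[j+k]Ck (m+n∸n≡m k j) ⟩
    (l C k) * (((k + k) C (j + k)) * (((j + k) C k) * (k C (l ∸ j))))
      ≡⟨ cong ((l C k) *_) (*-assoc ((k + k) C (j + k)) ((j + k) C k) (k C (l ∸ j))) ⟨
    (l C k) * ((((k + k) C (j + k)) * ((j + k) C k)) * (k C (l ∸ j)))
      ≡⟨ cong (λ a → (l C k) * (a * (k C (l ∸ j)))) (C-revision (k + k) (m≤n+m k j)) ⟩
    (l C k) * ((((k + k) C k) * (((k + k) ∸ k) C ((j + k) ∸ k))) * (k C (l ∸ j)))
      ≡⟨ cong₂ (λ a b → (l C k) * ((((k + k) C k) * (a C b)) * (k C (l ∸ j)))) (m+n∸m≡n k k) (m+n∸n≡m j k) ⟩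
    (l C k) * ((((k + k) C k) * (k C j)) * (k C (l ∸ j)))
      ≡⟨ shuffle₂ (l C k) ((k + k) C k) (k C j) (k C (l ∸ j)) ⟩
    ((l C k) * ((k + k) C k)) * ((k C j) * (k C (l ∸ j)))
      ∎
    where
    [k+j]Cj≡[j+k]Ck : (k + j) C j ≡ (j + k) C k
    [k+j]Cj≡[j+k]Ck = trans (sym (C-sym⁺ k j)) (cong (_C k) (+-comm k j))
    shuffle₁ : ∀ a b c d → a * (b * c * d) ≡ b * (a * (d * c))
    shuffle₁ = solve-∀
    shuffle₂ : ∀ a b c d → a * ((b * c) * d) ≡ (a * b) * (c * d)
    shuffle₂ = solve-∀

  ∑-linCoeff-upper : ∀ k l →
    ∑ (suc k) (λ j → ((k + k) C (j + k)) * linCoeff k j l) ≡ (l C k) * (((k + k) C k) * ((k + k) C l))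
  ∑-linCoeff-upper k l = begin
    ∑ (suc k) h
      ≡⟨ ∑-rebound (suc k) (suc l) h beyond-k beyond-l ⟩
    ∑ (suc l) h
      ≡⟨ ∑-cong (suc l) (λ j<1+l → linCoeff-upper-term k l (≤-pred j<1+l)) ⟩
    ∑ (suc l) (λ j → ((l C k) * ((k + k) C k)) * ((k C j) * (k C (l ∸ j))))
      ≡⟨ *-distribˡ-∑ (suc l) ((l C k) * ((k + k) C k)) _ ⟨
    ((l C k) * ((k + k) C k)) * ∑ (suc l) (λ j → (k C j) * (k C (l ∸ j)))
      ≡⟨ cong (((l C k) * ((k + k) C k)) *_) (vandermonde k k l) ⟩
    ((l C k) * ((k + k) C k)) * ((k + k) C l)
      ≡⟨ *-assoc (l C k) ((k + k) C k) ((k + k) C l) ⟩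
    (l C k) * (((k + k) C k) * ((k + k) C l))
      ∎
    where
    h : ℕ → ℕ
    h j = ((k + k) C (j + k)) * linCoeff k j l
    beyond-k : ∀ {j} → suc k ≤ j → h j ≡ 0
    beyond-k {j} k<j = cong (_* linCoeff k j l) (k>n⇒nCk≡0 (+-monoˡ-< k k<j))
    beyond-l : ∀ {j} → suc l ≤ j → h j ≡ 0
    beyond-l {j} l<j = trans (cong (λ a → ((k + k) C (j + k)) * ((l C k) * a * ((k + j) C l))) (k>n⇒nCk≡0 l<j))
                             (annihilate ((k + k) C (j + k)) (l C k) ((k + j) C l))
      where
      annihilate : ∀ a b c → a * (b * 0 * c) ≡ 0
      annihilate = solve-∀

  bilinearCoeff : ℕ → (ℕ → ℕ) → (ℕ → ℕ → ℕ) → ℕ → ℕ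
  bilinearCoeff N B w l = ∑ N (λ i → ∑ (B i) (λ j → w i j * linCoeff i j l))

  squareWeight : ℕ → ℕ → ℕ → ℕ
  squareWeight n i j = (n C i) * (n C j)

  rhsWeight : ℕ → ℕ → ℕ → ℕ
  rhsWeight n k j = ((n + k) C (k + k)) * ((k + k) C (j + k))

  squareWeight-vandermonde : ∀ n l i j →
    squareWeight n i j * linCoeff i j l
      ≡ ∑ (suc l) (λ t → ((n C i) * (l C i) * (i C t)) * ((n C j) * (l C j) * (j C (l ∸ t))))
  squareWeight-vandermonde n l i j = begin
    ((n C i) * (n C j)) * ((l C i) * (l C j) * ((i + j) C l))
      ≡⟨ cong (λ a → ((n C i) * (n C j)) * ((l C i) * (l C j) * a)) (vandermonde i j l) ⟨
    ((n C i) * (n C j)) * ((l C i) * (l C j) * ∑ (suc l) (λ t → (i C t) * (j C (l ∸ t))))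
      ≡⟨ *-assoc ((n C i) * (n C j)) ((l C i) * (l C j)) _ ⟨
    ((n C i) * (n C j)) * ((l C i) * (l C j)) * ∑ (suc l) (λ t → (i C t) * (j C (l ∸ t)))
      ≡⟨ *-distribˡ-∑ (suc l) (((n C i) * (n C j)) * ((l C i) * (l C j))) (λ t → (i C t) * (j C (l ∸ t))) ⟩
    ∑ (suc l) (λ t → ((n C i) * (n C j)) * ((l C i) * (l C j)) * ((i C t) * (j C (l ∸ t))))
      ≡⟨ ∑-cong′ (suc l) (λ t → shuffle (n C i) (n C j) (l C i) (l C j) (i C t) (j C (l ∸ t))) ⟩
    ∑ (suc l) (λ t → ((n C i) * (l C i) * (i C t)) * ((n C j) * (l C j) * (j C (l ∸ t))))
      ∎
    where
    shuffle : ∀ a b c d e f → (a * b) * (c * d) * (e * f) ≡ (a * c * e) * (b * d * f)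
    shuffle = solve-∀

  bilinearCoeff-square : ∀ n l →
    bilinearCoeff (suc n) (λ _ → suc n) (squareWeight n) l ≡ ∑ (suc l) (λ t → basisℕ n t * basisℕ n (l ∸ t))
  bilinearCoeff-square n l = begin
    ∑ (suc n) (λ i → ∑ (suc n) (λ j → squareWeight n i j * linCoeff i j l))
      ≡⟨ ∑-cong′ (suc n) (λ i → ∑-cong′ (suc n) (squareWeight-vandermonde n l i)) ⟩
    ∑ (suc n) (λ i → ∑ (suc n) (λ j → ∑ (suc l) (λ t → P i t * Q j t)))
      ≡⟨ ∑-cong′ (suc n) (λ i → ∑-comm (suc n) (suc l) (λ j t → P i t * Q j t)) ⟩
    ∑ (suc n) (λ i → ∑ (suc l) (λ t → ∑ (suc n) (λ j → P i t * Q j t)))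
      ≡⟨ ∑-comm (suc n) (suc l) (λ i t → ∑ (suc n) (λ j → P i t * Q j t)) ⟩
    ∑ (suc l) (λ t → ∑ (suc n) (λ i → ∑ (suc n) (λ j → P i t * Q j t)))
      ≡⟨ ∑-cong′ (suc l) (λ t → ∑-*-∑ (suc n) (suc n) (λ i → P i t) (λ j → Q j t)) ⟨
    ∑ (suc l) (λ t → ∑ (suc n) (λ i → P i t) * ∑ (suc n) (λ j → Q j t))
      ≡⟨ ∑-cong (suc l) (λ t<1+l → ∑-triple-choose-product n l _ (≤-pred t<1+l)) ⟩
    ∑ (suc l) (λ t → basisℕ n t * basisℕ n (l ∸ t))
      ∎
    where
    P Q : ℕ → ℕ → ℕ
    P i t = (n C i) * (l C i) * (i C t)
    Q j t = (n C j) * (l C j) * (j C (l ∸ t))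

  bilinearCoeff-rhs : ∀ n l →
    bilinearCoeff (suc n) suc (rhsWeight n) l ≡ ∑ (suc l) (λ k → ((l C k) * ((k + k) C l)) * basisℕ n k)
  bilinearCoeff-rhs n l = begin
    ∑ (suc n) (λ k → ∑ (suc k) (λ j → rhsWeight n k j * linCoeff k j l))
      ≡⟨ ∑-cong′ (suc n) inner ⟩
    ∑ (suc n) g
      ≡⟨ ∑-rebound (suc n) (suc l) g beyond-n beyond-l ⟩
    ∑ (suc l) g
      ∎
    where
    g : ℕ → ℕ
    g k = ((l C k) * ((k + k) C l)) * basisℕ n k
    beyond-n : ∀ {k} → suc n ≤ k → g k ≡ 0
    beyond-n {k} n<k = trans (cong (λ a → ((l C k) * ((k + k) C l)) * (a * ((n + k) C k))) (k>n⇒nCk≡0 n<k))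
                             (*-zeroʳ ((l C k) * ((k + k) C l)))
    beyond-l : ∀ {k} → suc l ≤ k → g k ≡ 0
    beyond-l {k} l<k = cong (λ a → (a * ((k + k) C l)) * basisℕ n k) (k>n⇒nCk≡0 l<k)
    inner : ∀ k → ∑ (suc k) (λ j → rhsWeight n k j * linCoeff k j l) ≡ g k
    inner k = begin
      ∑ (suc k) (λ j → (a * ((k + k) C (j + k))) * linCoeff k j l)
        ≡⟨ ∑-cong′ (suc k) (λ j → *-assoc a ((k + k) C (j + k)) (linCoeff k j l)) ⟩
      ∑ (suc k) (λ j → a * (((k + k) C (j + k)) * linCoeff k j l))
        ≡⟨ *-distribˡ-∑ (suc k) a _ ⟨
      a * ∑ (suc k) (λ j → ((k + k) C (j + k)) * linCoeff k j l)
        ≡⟨ cong (a *_) (∑-linCoeff-upper k l) ⟩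
      a * ((l C k) * (((k + k) C k) * ((k + k) C l)))
        ≡⟨ shuffle a (l C k) ((k + k) C k) ((k + k) C l) ⟩
      ((l C k) * ((k + k) C l)) * (a * ((k + k) C k))
        ≡⟨ cong (((l C k) * ((k + k) C l)) *_) (basisℕ-revision n k) ⟨
      g k
        ∎
      where
      a = (n + k) C (k + k)
      shuffle : ∀ a b c d → a * (b * (c * d)) ≡ (b * d) * (a * c)
      shuffle = solve-∀

-- Binomial coefficients over ℚ

open import Algebra.Bundles using (CommutativeRing; CommutativeMonoid)
open import Data.Nat using (ℕ) renaming (_+_ to _+ℕ_; _*_ to _*ℕ_)
open import Data.Nat.Base using (_!)
open import Data.Nat.Properties using (_!≢0)
open import Data.Nat.Combinatorics using (_C_; nCk+nC[k+1]≡[n+1]C[k+1])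
open import Data.Integer.Base as ℤ using (+_)
import Data.Integer.Properties as ℤ
import Data.Integer.Tactic.RingSolver as ℤ-Solver
open import Data.Rational.Base as ℚ using (ℚ; _+_; _*_; _-_; 0ℚ; 1ℚ; _/_; fromℚᵘ)
import Data.Rational.Properties as ℚ
open import Data.Rational.Unnormalised.Base as ℚᵘ using (mkℚᵘ; *≡*)
import Data.Rational.Unnormalised.Properties as ℚᵘ
open import Level using (0ℓ)
open import Relation.Nullary.Decidable.Core using (dec⇒maybe)
open import Tactic.RingSolver using (solve-∀)
open import Tactic.RingSolver.Core.AlmostCommutativeRing using (AlmostCommutativeRing; fromCommutativeRing)
open import Relation.Binary.PropositionalEquality
open ≡-Reasoning
open import Defs

ℚ-ring : AlmostCommutativeRing 0ℓ 0ℓ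
ℚ-ring = fromCommutativeRing ℚ.+-*-commutativeRing (λ q → dec⇒maybe (0ℚ ℚ.≟ q))

module ℚ∑ = RangeSum (CommutativeRing.commutativeSemiring ℚ.+-*-commutativeRing)
open ℚ∑
open import Algebra.Properties.CommutativeSemigroup (CommutativeMonoid.commutativeSemigroup ℚ.*-1-commutativeMonoid)
  using (x∙yz≈y∙xz; x∙yz≈zx∙y; x∙yz≈yx∙z; xy∙z≈y∙xz)

fromℚᵘ-homo-+ : ∀ p q → fromℚᵘ (p ℚᵘ.+ q) ≡ fromℚᵘ p + fromℚᵘ q
fromℚᵘ-homo-+ p q = ℚ.toℚᵘ-injective (ℚᵘ.≃-trans (ℚ.toℚᵘ-fromℚᵘ (p ℚᵘ.+ q)) (ℚᵘ.≃-sym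
  (ℚᵘ.≃-trans (ℚ.toℚᵘ-homo-+ (fromℚᵘ p) (fromℚᵘ q)) (ℚᵘ.+-cong (ℚ.toℚᵘ-fromℚᵘ p) (ℚ.toℚᵘ-fromℚᵘ q)))))

fromℚᵘ-homo-* : ∀ p q → fromℚᵘ (p ℚᵘ.* q) ≡ fromℚᵘ p * fromℚᵘ q
fromℚᵘ-homo-* p q = ℚ.toℚᵘ-injective (ℚᵘ.≃-trans (ℚ.toℚᵘ-fromℚᵘ (p ℚᵘ.* q)) (ℚᵘ.≃-sym
  (ℚᵘ.≃-trans (ℚ.toℚᵘ-homo-* (fromℚᵘ p) (fromℚᵘ q)) (ℚᵘ.*-cong (ℚ.toℚᵘ-fromℚᵘ p) (ℚ.toℚᵘ-fromℚᵘ q)))))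

-- ℕ→ℚ n and + 1 / suc d are definitionally fromℚᵘ (mkℚᵘ (+ n) 0) and fromℚᵘ (mkℚᵘ (+ 1) d),
-- so the following facts are computations in ℚᵘ.
ℕ→ℚ-+ : ∀ m n → ℕ→ℚ (m +ℕ n) ≡ ℕ→ℚ m + ℕ→ℚ n
ℕ→ℚ-+ m n = trans (ℚ.fromℚᵘ-cong ≃-+) (fromℚᵘ-homo-+ (mkℚᵘ (+ m) 0) (mkℚᵘ (+ n) 0))
  where
  unit : ∀ a b → (a ℤ.+ b) ℤ.* (+ 1 ℤ.* + 1) ≡ (a ℤ.* + 1 ℤ.+ b ℤ.* + 1) ℤ.* + 1
  unit = ℤ-Solver.solve-∀
  ≃-+ : mkℚᵘ (+ (m +ℕ n)) 0 ℚᵘ.≃ mkℚᵘ (+ m) 0 ℚᵘ.+ mkℚᵘ (+ n) 0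
  ≃-+ = *≡* (trans (cong (ℤ._* (+ 1 ℤ.* + 1)) (ℤ.pos-+ m n)) (unit (+ m) (+ n)))

ℕ→ℚ-* : ∀ m n → ℕ→ℚ (m *ℕ n) ≡ ℕ→ℚ m * ℕ→ℚ n
ℕ→ℚ-* m n = trans (ℚ.fromℚᵘ-cong ≃-*) (fromℚᵘ-homo-* (mkℚᵘ (+ m) 0) (mkℚᵘ (+ n) 0))
  where
  unit : ∀ a b → (a ℤ.* b) ℤ.* (+ 1 ℤ.* + 1) ≡ (a ℤ.* b) ℤ.* + 1
  unit = ℤ-Solver.solve-∀
  ≃-* : mkℚᵘ (+ (m *ℕ n)) 0 ℚᵘ.≃ mkℚᵘ (+ m) 0 ℚᵘ.* mkℚᵘ (+ n) 0
  ≃-* = *≡* (trans (cong (ℤ._* (+ 1 ℤ.* + 1)) (ℤ.pos-* m n)) (unit (+ m) (+ n)))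

ℕ→ℚ-∑ : ∀ n (f : ℕ → ℕ) → ℕ→ℚ (ℕ∑.∑ n f) ≡ ∑ n (λ k → ℕ→ℚ (f k))
ℕ→ℚ-∑ zero    f = refl
ℕ→ℚ-∑ (suc n) f = trans (ℕ→ℚ-+ (ℕ∑.∑ n f) (f n)) (cong (_+ ℕ→ℚ (f n)) (ℕ→ℚ-∑ n f))

ℕ→ℚ-inverse : ∀ n .{{_ : ℕ.NonZero n}} → ℕ→ℚ n * (+ 1 / n) ≡ 1ℚ
ℕ→ℚ-inverse (suc d) = trans (sym (fromℚᵘ-homo-* (mkℚᵘ (+ suc d) 0) (mkℚᵘ (+ 1) d)))
                            (ℚ.fromℚᵘ-cong (ℚᵘ.*-inverseʳ (mkℚᵘ (+ suc d) 0)))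

ℕ→ℚ-cancelˡ : ∀ n .{{_ : ℕ.NonZero n}} {p q} → ℕ→ℚ n * p ≡ ℕ→ℚ n * q → p ≡ q
ℕ→ℚ-cancelˡ n {p} {q} np≡nq = trans (sym (undo p)) (trans (cong (+ 1 / n *_) np≡nq) (undo q))
  where
  undo : ∀ r → + 1 / n * (ℕ→ℚ n * r) ≡ r
  undo r = trans (sym (ℚ.*-assoc (+ 1 / n) (ℕ→ℚ n) r))
                 (trans (cong (_* r) (trans (ℚ.*-comm (+ 1 / n) (ℕ→ℚ n)) (ℕ→ℚ-inverse n))) (ℚ.*-identityˡ r))

choose-pascal : ∀ n k → choose (suc n) (suc k) ≡ choose n k + choose n (suc k)
choose-pascal n k = trans (cong ℕ→ℚ (sym (nCk+nC[k+1]≡[n+1]C[k+1] n k))) (ℕ→ℚ-+ (n C k) (n C suc k))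

choose-absorption : ∀ n k → ℕ→ℚ (suc k) * choose n (suc k) ≡ (ℕ→ℚ n - ℕ→ℚ k) * choose n k
choose-absorption n k = begin
  ℕ→ℚ (suc k) * choose n (suc k)                      ≡⟨ rearrange (ℕ→ℚ (suc k)) (choose n (suc k)) (choose n k) (ℕ→ℚ k) ⟩
  (choose n (suc k) * ℕ→ℚ (suc k) + choose n k * ℕ→ℚ k) - choose n k * ℕ→ℚ k
                                                      ≡⟨ cong (_- choose n k * ℕ→ℚ k) cast-absorption ⟩
  choose n k * ℕ→ℚ n - choose n k * ℕ→ℚ k            ≡⟨ factor (choose n k) (ℕ→ℚ n) (ℕ→ℚ k) ⟩
  (ℕ→ℚ n - ℕ→ℚ k) * choose n k                        ∎
  where
  rearrange : ∀ s a c k → s * a ≡ (a * s + c * k) - c * k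
  rearrange = solve-∀ ℚ-ring
  factor : ∀ c n k → c * n - c * k ≡ (n - k) * c
  factor = solve-∀ ℚ-ring
  cast-absorption : choose n (suc k) * ℕ→ℚ (suc k) + choose n k * ℕ→ℚ k ≡ choose n k * ℕ→ℚ n
  cast-absorption = begin
    choose n (suc k) * ℕ→ℚ (suc k) + choose n k * ℕ→ℚ k ≡⟨ cong₂ _+_ (ℕ→ℚ-* (n C suc k) (suc k)) (ℕ→ℚ-* (n C k) k) ⟨
    ℕ→ℚ ((n C suc k) *ℕ suc k) + ℕ→ℚ ((n C k) *ℕ k)   ≡⟨ ℕ→ℚ-+ ((n C suc k) *ℕ suc k) ((n C k) *ℕ k) ⟨
    ℕ→ℚ ((n C suc k) *ℕ suc k +ℕ (n C k) *ℕ k)       ≡⟨ cong ℕ→ℚ (C-absorption n k) ⟩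
    ℕ→ℚ ((n C k) *ℕ n)                                 ≡⟨ ℕ→ℚ-* (n C k) n ⟩
    choose n k * ℕ→ℚ n                                  ∎

choose-absorption-upper : ∀ m k → ℕ→ℚ (suc m) * choose m k ≡ (ℕ→ℚ (suc m) - ℕ→ℚ k) * choose (suc m) k
choose-absorption-upper m k = begin
  ℕ→ℚ (suc m) * choose m k
    ≡⟨ cong (_* choose m k) (ℕ→ℚ-+ 1 m) ⟩
  (1ℚ + ℕ→ℚ m) * choose m k
    ≡⟨ split (ℕ→ℚ m) (ℕ→ℚ k) (choose m k) ⟩
  (1ℚ + ℕ→ℚ k) * choose m k + (ℕ→ℚ m - ℕ→ℚ k) * choose m k
    ≡⟨ cong₂ (λ a b → a * choose m k + b) (ℕ→ℚ-+ 1 k) (choose-absorption m k) ⟨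
  ℕ→ℚ (suc k) * choose m k + ℕ→ℚ (suc k) * choose m (suc k)
    ≡⟨ ℚ.*-distribˡ-+ (ℕ→ℚ (suc k)) (choose m k) (choose m (suc k)) ⟨
  ℕ→ℚ (suc k) * (choose m k + choose m (suc k))
    ≡⟨ cong (ℕ→ℚ (suc k) *_) (choose-pascal m k) ⟨
  ℕ→ℚ (suc k) * choose (suc m) (suc k)
    ≡⟨ choose-absorption (suc m) k ⟩
  (ℕ→ℚ (suc m) - ℕ→ℚ k) * choose (suc m) k ∎
  where
  split : ∀ m k c → (1ℚ + m) * c ≡ (1ℚ + k) * c + (m - k) * c
  split = solve-∀ ℚ-ring

falling-shift : ∀ x k → falling x (suc k) ≡ x * falling (x - 1ℚ) k
falling-shift x zero    = unit x
  where
  unit : ∀ x → 1ℚ * (x - 0ℚ) ≡ x * 1ℚ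
  unit = solve-∀ ℚ-ring
falling-shift x (suc k) = begin
  falling x (suc k) * (x - ℕ→ℚ (suc k))         ≡⟨ cong₂ (λ a b → a * (x - b)) (falling-shift x k) (ℕ→ℚ-+ 1 k) ⟩
  x * falling (x - 1ℚ) k * (x - (1ℚ + ℕ→ℚ k))   ≡⟨ regroup x (falling (x - 1ℚ) k) (ℕ→ℚ k) ⟩
  x * (falling (x - 1ℚ) k * ((x - 1ℚ) - ℕ→ℚ k)) ∎
  where
  regroup : ∀ x f k → x * f * (x - (1ℚ + k)) ≡ x * (f * ((x - 1ℚ) - k))
  regroup = solve-∀ ℚ-ring

binom-falling : ∀ x k → ℕ→ℚ (k !) * binom x k ≡ falling x k
binom-falling x k = begin
  ℕ→ℚ (k !) * (falling x k * (+ 1 / k !))     ≡⟨ x∙yz≈y∙xz (ℕ→ℚ (k !)) (falling x k) (+ 1 / k !) ⟩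
  falling x k * (ℕ→ℚ (k !) * (+ 1 / k !))     ≡⟨ cong (falling x k *_) (ℕ→ℚ-inverse (k !)) ⟩
  falling x k * 1ℚ                            ≡⟨ ℚ.*-identityʳ (falling x k) ⟩
  falling x k                                 ∎
  where instance _ = k !≢0

binom-suc-factorial : ∀ x k → ℕ→ℚ (k !) * (binom x (suc k) * ℕ→ℚ (suc k)) ≡ falling x (suc k)
binom-suc-factorial x k = begin
  ℕ→ℚ (k !) * (binom x (suc k) * ℕ→ℚ (suc k))  ≡⟨ x∙yz≈zx∙y (ℕ→ℚ (k !)) (binom x (suc k)) (ℕ→ℚ (suc k)) ⟩
  ℕ→ℚ (suc k) * ℕ→ℚ (k !) * binom x (suc k)    ≡⟨ cong (_* binom x (suc k)) (ℕ→ℚ-* (suc k) (k !)) ⟨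
  ℕ→ℚ (suc k !) * binom x (suc k)              ≡⟨ binom-falling x (suc k) ⟩
  falling x (suc k)                            ∎

binom-suc : ∀ x k → binom x (suc k) * ℕ→ℚ (suc k) ≡ binom x k * (x - ℕ→ℚ k)
binom-suc x k = ℕ→ℚ-cancelˡ (k !) (begin
  ℕ→ℚ (k !) * (binom x (suc k) * ℕ→ℚ (suc k))  ≡⟨ binom-suc-factorial x k ⟩
  falling x k * (x - ℕ→ℚ k)                    ≡⟨ cong (_* (x - ℕ→ℚ k)) (binom-falling x k) ⟨
  ℕ→ℚ (k !) * binom x k * (x - ℕ→ℚ k)          ≡⟨ ℚ.*-assoc (ℕ→ℚ (k !)) (binom x k) (x - ℕ→ℚ k) ⟩
  ℕ→ℚ (k !) * (binom x k * (x - ℕ→ℚ k))        ∎)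
  where instance _ = k !≢0

binom-suc-upper : ∀ x k → binom x (suc k) * ℕ→ℚ (suc k) ≡ x * binom (x - 1ℚ) k
binom-suc-upper x k = ℕ→ℚ-cancelˡ (k !) (begin
  ℕ→ℚ (k !) * (binom x (suc k) * ℕ→ℚ (suc k))  ≡⟨ binom-suc-factorial x k ⟩
  falling x (suc k)                            ≡⟨ falling-shift x k ⟩
  x * falling (x - 1ℚ) k                       ≡⟨ cong (x *_) (binom-falling (x - 1ℚ) k) ⟨
  x * (ℕ→ℚ (k !) * binom (x - 1ℚ) k)           ≡⟨ x∙yz≈y∙xz x (ℕ→ℚ (k !)) (binom (x - 1ℚ) k) ⟩
  ℕ→ℚ (k !) * (x * binom (x - 1ℚ) k)           ∎)
  where instance _ = k !≢0

binom-ℕ : ∀ n k → binom (ℕ→ℚ n) k ≡ choose n k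
binom-ℕ n zero    = refl
binom-ℕ n (suc k) = ℕ→ℚ-cancelˡ (suc k) (begin
  ℕ→ℚ (suc k) * binom (ℕ→ℚ n) (suc k)  ≡⟨ ℚ.*-comm (ℕ→ℚ (suc k)) (binom (ℕ→ℚ n) (suc k)) ⟩
  binom (ℕ→ℚ n) (suc k) * ℕ→ℚ (suc k)  ≡⟨ binom-suc (ℕ→ℚ n) k ⟩
  binom (ℕ→ℚ n) k * (ℕ→ℚ n - ℕ→ℚ k)    ≡⟨ cong (_* (ℕ→ℚ n - ℕ→ℚ k)) (binom-ℕ n k) ⟩
  choose n k * (ℕ→ℚ n - ℕ→ℚ k)         ≡⟨ ℚ.*-comm (choose n k) (ℕ→ℚ n - ℕ→ℚ k) ⟩
  (ℕ→ℚ n - ℕ→ℚ k) * choose n k         ≡⟨ choose-absorption n k ⟨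
  ℕ→ℚ (suc k) * choose n (suc k)       ∎)

-- The basis C(x,k) C(x+k,k) and its linearization

basis : ℚ → ℕ → ℚ
basis x k = binom x k * binom (x + ℕ→ℚ k) k

pronic : ℕ → ℚ
pronic l = ℕ→ℚ l * ℕ→ℚ (suc l)

square : ℕ → ℚ
square l = ℕ→ℚ l * ℕ→ℚ l

basis-suc : ∀ x k → basis x (suc k) * square (suc k) ≡ basis x k * (x * (x + 1ℚ) - pronic k)
basis-suc x k = begin
  binom x (suc k) * binom y (suc k) * (S * S)
    ≡⟨ interchange (binom x (suc k)) (binom y (suc k)) S ⟩
  (binom x (suc k) * S) * (binom y (suc k) * S)
    ≡⟨ cong₂ _*_ (binom-suc x k) (binom-suc-upper y k) ⟩
  (binom x k * (x - K)) * (y * binom (y - 1ℚ) k)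
    ≡⟨ cong₂ (λ a b → (binom x k * (x - K)) * ((x + a) * binom b k)) 1+K≡S x+K≡y-1 ⟨
  (binom x k * (x - K)) * ((x + (1ℚ + K)) * binom (x + K) k)
    ≡⟨ regroup (binom x k) (binom (x + K) k) x K ⟩
  basis x k * (x * (x + 1ℚ) - K * (1ℚ + K))
    ≡⟨ cong (λ a → basis x k * (x * (x + 1ℚ) - K * a)) 1+K≡S ⟩
  basis x k * (x * (x + 1ℚ) - pronic k)
    ∎
  where
  K = ℕ→ℚ k
  S = ℕ→ℚ (suc k)
  y = x + S
  1+K≡S : 1ℚ + K ≡ S
  1+K≡S = sym (ℕ→ℚ-+ 1 k)
  x+K≡y-1 : x + K ≡ y - 1ℚ
  x+K≡y-1 = trans (cancel x K) (cong (λ a → (x + a) - 1ℚ) 1+K≡S)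
    where
    cancel : ∀ x K → x + K ≡ (x + (1ℚ + K)) - 1ℚ
    cancel = solve-∀ ℚ-ring
  interchange : ∀ a b c → a * b * (c * c) ≡ (a * c) * (b * c)
  interchange = solve-∀ ℚ-ring
  regroup : ∀ a b x K → (a * (x - K)) * ((x + (1ℚ + K)) * b) ≡ a * b * (x * (x + 1ℚ) - K * (1ℚ + K))
  regroup = solve-∀ ℚ-ring

basis-raise : ∀ x l → x * (x + 1ℚ) * basis x l ≡ pronic l * basis x l + square (suc l) * basis x (suc l)
basis-raise x l = begin
  x * (x + 1ℚ) * basis x l
    ≡⟨ split (x * (x + 1ℚ)) (pronic l) (basis x l) ⟩
  pronic l * basis x l + basis x l * (x * (x + 1ℚ) - pronic l)
    ≡⟨ cong (_+_ (pronic l * basis x l)) (basis-suc x l) ⟨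
  pronic l * basis x l + basis x (suc l) * square (suc l)
    ≡⟨ cong (_+_ (pronic l * basis x l)) (ℚ.*-comm (basis x (suc l)) (square (suc l))) ⟩
  pronic l * basis x l + square (suc l) * basis x (suc l)
    ∎
  where
  split : ∀ y p b → y * b ≡ p * b + b * (y - p)
  split = solve-∀ ℚ-ring

basis-raise-scaled : ∀ x p c l →
  (x * (x + 1ℚ) - p) * (c * basis x l) ≡ (pronic l - p) * c * basis x l + square (suc l) * c * basis x (suc l)
basis-raise-scaled x p c l = begin
  (y - p) * (c * basis x l)
    ≡⟨ expand y p c (basis x l) ⟩
  c * (y * basis x l) - p * (c * basis x l)
    ≡⟨ cong (λ a → c * a - p * (c * basis x l)) (basis-raise x l) ⟩
  c * (pronic l * basis x l + square (suc l) * basis x (suc l)) - p * (c * basis x l)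
    ≡⟨ collect c (pronic l) p (square (suc l)) (basis x l) (basis x (suc l)) ⟩
  (pronic l - p) * c * basis x l + square (suc l) * c * basis x (suc l)
    ∎
  where
  y = x * (x + 1ℚ)
  expand : ∀ y p c b → (y - p) * (c * b) ≡ c * (y * b) - p * (c * b)
  expand = solve-∀ ℚ-ring
  collect : ∀ c q p s b b′ → c * (q * b + s * b′) - p * (c * b) ≡ (q - p) * c * b + s * c * b′
  collect = solve-∀ ℚ-ring

basis-ℕ : ∀ n k → basis (ℕ→ℚ n) k ≡ ℕ→ℚ (basisℕ n k)
basis-ℕ n k = begin
  binom (ℕ→ℚ n) k * binom (ℕ→ℚ n + ℕ→ℚ k) k  ≡⟨ cong (λ a → binom (ℕ→ℚ n) k * binom a k) (ℕ→ℚ-+ n k) ⟨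
  binom (ℕ→ℚ n) k * binom (ℕ→ℚ (n +ℕ k)) k  ≡⟨ cong₂ _*_ (binom-ℕ n k) (binom-ℕ (n +ℕ k) k) ⟩
  choose n k * choose (n +ℕ k) k            ≡⟨ ℕ→ℚ-* (n C k) ((n +ℕ k) C k) ⟨
  ℕ→ℚ (basisℕ n k)                           ∎

linCoeff-split : ∀ i j l → ℕ→ℚ (linCoeff i j l) ≡ choose l i * choose l j * choose (i +ℕ j) l
linCoeff-split i j l = trans (ℕ→ℚ-* ((l C i) *ℕ (l C j)) ((i +ℕ j) C l))
                             (cong (_* choose (i +ℕ j) l) (ℕ→ℚ-* (l C i) (l C j)))

-- I, J, K, S, L, IJ stand for i, j, l, i+1, l+1, i+j; the hypotheses are the absorption identities
-- relating Ci = C(l+1,i), C′i = C(l+1,i+1), Cj = C(l+1,j), ci = C(l,i), cj = C(l,j), A = C(i+j,l), B = C(i+j,l+1).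
recurrence-algebra : ∀ {I J K S L IJ A B Ci C′i Cj ci cj : ℚ} →
  S ≡ 1ℚ + I → L ≡ 1ℚ + K → IJ ≡ I + J →
  S * C′i ≡ (L - I) * Ci → L * B ≡ (IJ - K) * A → L * ci ≡ (L - I) * Ci → L * cj ≡ (L - J) * Cj →
  (S * S) * (C′i * Cj * (A + B)) ≡ (L * (1ℚ + L) - I * S) * (Ci * Cj * B) + (L * L) * (ci * cj * A)
recurrence-algebra {I} {J} {K} {A = A} {B} {Ci} {C′i} {Cj} {ci} {cj} refl refl refl upper-i lower-ij upper-l-i upper-l-j =
  begin
  (S * S) * (C′i * Cj * (A + B))
    ≡⟨ step₁ S C′i Cj A B ⟩
  S * (S * C′i) * Cj * (A + B)
    ≡⟨ cong (λ a → S * a * Cj * (A + B)) upper-i ⟩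
  S * ((L - I) * Ci) * Cj * (A + B)
    ≡⟨ step₂ I J K A B Ci Cj ⟩
  (L - I) * Ci * Cj * (((I + J) - K) * A + (L - J) * A + S * B)
    ≡⟨ cong (λ a → (L - I) * Ci * Cj * (a + (L - J) * A + S * B)) lower-ij ⟨
  (L - I) * Ci * Cj * (L * B + (L - J) * A + S * B)
    ≡⟨ step₃ I J K A B Ci Cj ⟩
  (L * (1ℚ + L) - I * S) * (Ci * Cj * B) + ((L - I) * Ci) * ((L - J) * Cj) * A
    ≡⟨ cong₂ (λ a b → (L * (1ℚ + L) - I * S) * (Ci * Cj * B) + a * b * A) upper-l-i upper-l-j ⟨
  (L * (1ℚ + L) - I * S) * (Ci * Cj * B) + (L * ci) * (L * cj) * A
    ≡⟨ cong (_+_ ((L * (1ℚ + L) - I * S) * (Ci * Cj * B))) (step₄ L ci cj A) ⟩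
  (L * (1ℚ + L) - I * S) * (Ci * Cj * B) + (L * L) * (ci * cj * A) ∎
  where
  S = 1ℚ + I
  L = 1ℚ + K
  step₁ : ∀ S C′i Cj A B → (S * S) * (C′i * Cj * (A + B)) ≡ S * (S * C′i) * Cj * (A + B)
  step₁ = solve-∀ ℚ-ring
  step₂ : ∀ I J K A B Ci Cj → (1ℚ + I) * (((1ℚ + K) - I) * Ci) * Cj * (A + B)
                             ≡ ((1ℚ + K) - I) * Ci * Cj * (((I + J) - K) * A + ((1ℚ + K) - J) * A + (1ℚ + I) * B)
  step₂ = solve-∀ ℚ-ring
  step₃ : ∀ I J K A B Ci Cj → ((1ℚ + K) - I) * Ci * Cj * ((1ℚ + K) * B + ((1ℚ + K) - J) * A + (1ℚ + I) * B)
                             ≡ ((1ℚ + K) * (1ℚ + (1ℚ + K)) - I * (1ℚ + I)) * (Ci * Cj * B)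
                               + (((1ℚ + K) - I) * Ci) * (((1ℚ + K) - J) * Cj) * A
  step₃ = solve-∀ ℚ-ring
  step₄ : ∀ L a b c → (L * a) * (L * b) * c ≡ (L * L) * (a * b * c)
  step₄ = solve-∀ ℚ-ring

linCoeff-recurrence : ∀ i j l →
  square (suc i) * ℕ→ℚ (linCoeff (suc i) j (suc l))
    ≡ (pronic (suc l) - pronic i) * ℕ→ℚ (linCoeff i j (suc l)) + square (suc l) * ℕ→ℚ (linCoeff i j l)
linCoeff-recurrence i j l = begin
  square (suc i) * ℕ→ℚ (linCoeff (suc i) j (suc l))
    ≡⟨ cong (square (suc i) *_) (linCoeff-split (suc i) j (suc l)) ⟩
  square (suc i) * (choose (suc l) (suc i) * choose (suc l) j * choose (suc (i +ℕ j)) (suc l))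
    ≡⟨ cong (λ a → square (suc i) * (choose (suc l) (suc i) * choose (suc l) j * a)) (choose-pascal (i +ℕ j) l) ⟩
  square (suc i) * (choose (suc l) (suc i) * choose (suc l) j * (choose (i +ℕ j) l + choose (i +ℕ j) (suc l)))
    ≡⟨ recurrence-algebra (ℕ→ℚ-+ 1 i) (ℕ→ℚ-+ 1 l) (ℕ→ℚ-+ i j) (choose-absorption (suc l) i) (choose-absorption (i +ℕ j) l)
                          (choose-absorption-upper l i) (choose-absorption-upper l j) ⟩
  (ℕ→ℚ (suc l) * (1ℚ + ℕ→ℚ (suc l)) - pronic i) * c₊ + square (suc l) * c
    ≡⟨ cong (λ a → (ℕ→ℚ (suc l) * a - pronic i) * c₊ + square (suc l) * c) (ℕ→ℚ-+ 1 (suc l)) ⟨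
  (pronic (suc l) - pronic i) * c₊ + square (suc l) * c
    ≡⟨ cong₂ (λ a b → (pronic (suc l) - pronic i) * a + square (suc l) * b) (linCoeff-split i j (suc l)) (linCoeff-split i j l) ⟨
  (pronic (suc l) - pronic i) * ℕ→ℚ (linCoeff i j (suc l)) + square (suc l) * ℕ→ℚ (linCoeff i j l)
    ∎
  where
  c₊ = choose (suc l) i * choose (suc l) j * choose (i +ℕ j) (suc l)
  c  = choose l i * choose l j * choose (i +ℕ j) l

linCoeff-recurrence₀ : ∀ i j →
  square (suc i) * ℕ→ℚ (linCoeff (suc i) j 0) ≡ (pronic 0 - pronic i) * ℕ→ℚ (linCoeff i j 0)
linCoeff-recurrence₀ zero    j = trans (ℚ.*-zeroʳ (square 1)) (sym (ℚ.*-zeroˡ (ℕ→ℚ (linCoeff 0 j 0))))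
linCoeff-recurrence₀ (suc i) j = trans (ℚ.*-zeroʳ (square (suc (suc i)))) (sym (ℚ.*-zeroʳ (pronic 0 - pronic (suc i))))

linearization-step : ∀ x i j →
  (x * (x + 1ℚ) - pronic i) * ∑ (suc (i +ℕ j)) (λ l → ℕ→ℚ (linCoeff i j l) * basis x l)
    ≡ square (suc i) * ∑ (suc (suc i +ℕ j)) (λ l → ℕ→ℚ (linCoeff (suc i) j l) * basis x l)
linearization-step x i j = begin
  (y - pronic i) * ∑ N (λ l → κ l * basis x l)          ≡⟨ *-distribˡ-∑ N (y - pronic i) (λ l → κ l * basis x l) ⟩
  ∑ N (λ l → (y - pronic i) * (κ l * basis x l))        ≡⟨ ∑-cong′ N (λ l → basis-raise-scaled x (pronic i) (κ l) l) ⟩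
  ∑ N (λ l → D l * basis x l + E l * basis x (suc l))   ≡⟨ ∑-+-shift N (λ l → D l * basis x l) (λ l → E l * basis x (suc l)) top ⟩
  D 0 * basis x 0 + ∑ N (λ l → D (suc l) * basis x (suc l) + E l * basis x (suc l))
    ≡⟨ cong₂ _+_ (cong (_* basis x 0) (linCoeff-recurrence₀ i j)) (∑-cong′ N merge) ⟨
  G 0 + ∑ N (λ l → G (suc l))                           ≡⟨ ∑-suc N G ⟨
  ∑ (suc N) G                                           ≡⟨ ∑-cong′ (suc N) (λ l → ℚ.*-assoc (square (suc i)) (κ′ l) (basis x l)) ⟩
  ∑ (suc N) (λ l → square (suc i) * (κ′ l * basis x l)) ≡⟨ *-distribˡ-∑ (suc N) (square (suc i)) (λ l → κ′ l * basis x l) ⟨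
  square (suc i) * ∑ (suc N) (λ l → κ′ l * basis x l)   ∎
  where
  N = suc (i +ℕ j)
  y = x * (x + 1ℚ)
  κ κ′ D E G : ℕ → ℚ
  κ l = ℕ→ℚ (linCoeff i j l)
  κ′ l = ℕ→ℚ (linCoeff (suc i) j l)
  D l = (pronic l - pronic i) * κ l
  E l = square (suc l) * κ l
  G l = square (suc i) * κ′ l * basis x l
  top : D N * basis x N ≡ 0ℚ
  top = begin
    (pronic N - pronic i) * κ N * basis x N
      ≡⟨ cong (λ a → (pronic N - pronic i) * ℕ→ℚ a * basis x N) (linCoeff-vanishes {i} {j} (ℕ.n<1+n (i +ℕ j))) ⟩
    (pronic N - pronic i) * 0ℚ * basis x N
      ≡⟨ cong (_* basis x N) (ℚ.*-zeroʳ (pronic N - pronic i)) ⟩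
    0ℚ * basis x N
      ≡⟨ ℚ.*-zeroˡ (basis x N) ⟩
    0ℚ
      ∎
  merge : ∀ l → G (suc l) ≡ D (suc l) * basis x (suc l) + E l * basis x (suc l)
  merge l = begin
    square (suc i) * κ′ (suc l) * basis x (suc l)       ≡⟨ cong (_* basis x (suc l)) (linCoeff-recurrence i j l) ⟩
    (D (suc l) + E l) * basis x (suc l)                 ≡⟨ ℚ.*-distribʳ-+ (basis x (suc l)) (D (suc l)) (E l) ⟩
    D (suc l) * basis x (suc l) + E l * basis x (suc l) ∎

basis-linearization : ∀ x i j →
  basis x i * basis x j ≡ ∑ (suc (i +ℕ j)) (λ l → ℕ→ℚ (linCoeff i j l) * basis x l)
basis-linearization x zero j = begin
  1ℚ * basis x j
    ≡⟨ cong (λ a → ℕ→ℚ a * basis x j) (linCoeff-diagonal₀ j) ⟨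
  ℕ→ℚ (linCoeff 0 j j) * basis x j
    ≡⟨ ∑-δ {n = suc j} (λ l → ℕ→ℚ (linCoeff 0 j l) * basis x l) (ℕ.n<1+n j) off-diagonal ⟨
  ∑ (suc j) (λ l → ℕ→ℚ (linCoeff 0 j l) * basis x l)
    ∎
  where
  off-diagonal : ∀ {l} → l ≢ j → ℕ→ℚ (linCoeff 0 j l) * basis x l ≡ 0ℚ
  off-diagonal {l} l≢j = trans (cong (λ a → ℕ→ℚ a * basis x l) (linCoeff-off-diagonal₀ l≢j)) (ℚ.*-zeroˡ (basis x l))
basis-linearization x (suc i) j = ℕ→ℚ-cancelˡ (suc i *ℕ suc i) (begin
  ℕ→ℚ (suc i *ℕ suc i) * (basis x (suc i) * basis x j)   ≡⟨ cong (_* (basis x (suc i) * basis x j)) (ℕ→ℚ-* (suc i) (suc i)) ⟩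
  square (suc i) * (basis x (suc i) * basis x j)         ≡⟨ x∙yz≈yx∙z (square (suc i)) (basis x (suc i)) (basis x j) ⟩
  basis x (suc i) * square (suc i) * basis x j           ≡⟨ cong (_* basis x j) (basis-suc x i) ⟩
  basis x i * (y - pronic i) * basis x j                 ≡⟨ xy∙z≈y∙xz (basis x i) (y - pronic i) (basis x j) ⟩
  (y - pronic i) * (basis x i * basis x j)               ≡⟨ cong ((y - pronic i) *_) (basis-linearization x i j) ⟩
  (y - pronic i) * ∑ (suc (i +ℕ j)) (λ l → ℕ→ℚ (linCoeff i j l) * basis x l)
                                                         ≡⟨ linearization-step x i j ⟩
  square (suc i) * expansion                                    ≡⟨ cong (_* expansion) (ℕ→ℚ-* (suc i) (suc i)) ⟨
  ℕ→ℚ (suc i *ℕ suc i) * expansion                              ∎)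
  where
  y = x * (x + 1ℚ)
  expansion = ∑ (suc (suc i +ℕ j)) (λ l → ℕ→ℚ (linCoeff (suc i) j l) * basis x l)

basis-convolution : ∀ x l →
  ∑ (suc l) (λ t → basis x t * basis x (l ∸ t)) ≡ ∑ (suc l) (λ k → ℕ→ℚ ((l C k) *ℕ ((k +ℕ k) C l)) * basis x k)
basis-convolution x l = begin
  ∑ (suc l) (λ t → basis x t * basis x (l ∸ t))
    ≡⟨ ∑-cong (suc l) (λ t<1+l → linearize (ℕ.≤-pred t<1+l)) ⟩
  ∑ (suc l) (λ t → ∑ (suc l) (λ k → κ t k * basis x k))
    ≡⟨ ∑-comm (suc l) (suc l) (λ t k → κ t k * basis x k) ⟩
  ∑ (suc l) (λ k → ∑ (suc l) (λ t → κ t k * basis x k))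
    ≡⟨ ∑-cong′ (suc l) (λ k → *-distribʳ-∑ (suc l) (basis x k) (λ t → κ t k)) ⟨
  ∑ (suc l) (λ k → ∑ (suc l) (λ t → κ t k) * basis x k)
    ≡⟨ ∑-cong′ (suc l) (λ k → cong (_* basis x k) (trans (sym (ℕ→ℚ-∑ (suc l) (λ t → linCoeff t (l ∸ t) k)))
                                                        (cong ℕ→ℚ (∑-linCoeff-antidiagonal l k)))) ⟩
  ∑ (suc l) (λ k → ℕ→ℚ ((l C k) *ℕ ((k +ℕ k) C l)) * basis x k)
    ∎
  where
  κ : ℕ → ℕ → ℚ
  κ t k = ℕ→ℚ (linCoeff t (l ∸ t) k)
  linearize : ∀ {t} → t ≤ l → basis x t * basis x (l ∸ t) ≡ ∑ (suc l) (λ k → κ t k * basis x k)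
  linearize {t} t≤l = trans (basis-linearization x t (l ∸ t))
                            (cong (λ m → ∑ (suc m) (λ k → κ t k * basis x k)) (ℕ.m+[n∸m]≡n t≤l))

scaled-linearization : ∀ x M w i j → i +ℕ j < M →
  ℕ→ℚ w * (basis x i * basis x j) ≡ ∑ M (λ l → ℕ→ℚ (w *ℕ linCoeff i j l) * basis x l)
scaled-linearization x M w i j i+j<M = begin
  ℕ→ℚ w * (basis x i * basis x j)                                   ≡⟨ cong (ℕ→ℚ w *_) (basis-linearization x i j) ⟩
  ℕ→ℚ w * ∑ (suc (i +ℕ j)) (λ l → ℕ→ℚ (linCoeff i j l) * basis x l) ≡⟨ cong (ℕ→ℚ w *_) (∑-extend f i+j<M beyond) ⟨
  ℕ→ℚ w * ∑ M f                                                     ≡⟨ *-distribˡ-∑ M (ℕ→ℚ w) f ⟩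
  ∑ M (λ l → ℕ→ℚ w * (ℕ→ℚ (linCoeff i j l) * basis x l))            ≡⟨ ∑-cong′ M regroup ⟩
  ∑ M (λ l → ℕ→ℚ (w *ℕ linCoeff i j l) * basis x l)                 ∎
  where
  f : ℕ → ℚ
  f l = ℕ→ℚ (linCoeff i j l) * basis x l
  beyond : ∀ {l} → suc (i +ℕ j) ≤ l → f l ≡ 0ℚ
  beyond {l} i+j<l = trans (cong (λ a → ℕ→ℚ a * basis x l) (linCoeff-vanishes {i} {j} i+j<l)) (ℚ.*-zeroˡ (basis x l))
  regroup : ∀ l → ℕ→ℚ w * (ℕ→ℚ (linCoeff i j l) * basis x l) ≡ ℕ→ℚ (w *ℕ linCoeff i j l) * basis x l
  regroup l = trans (sym (ℚ.*-assoc (ℕ→ℚ w) (ℕ→ℚ (linCoeff i j l)) (basis x l)))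
                    (cong (_* basis x l) (sym (ℕ→ℚ-* w (linCoeff i j l))))

bilinear-expansion : ∀ x N (B : ℕ → ℕ) M (w : ℕ → ℕ → ℕ) → (∀ {i j} → i < N → j < B i → i +ℕ j < M) →
  ∑ N (λ i → ∑ (B i) (λ j → ℕ→ℚ (w i j) * (basis x i * basis x j))) ≡ ∑ M (λ l → ℕ→ℚ (bilinearCoeff N B w l) * basis x l)
bilinear-expansion x N B M w i+j<M = begin
  ∑ N (λ i → ∑ (B i) (λ j → ℕ→ℚ (w i j) * (basis x i * basis x j)))
    ≡⟨ ∑-cong N (λ {i} i<N → ∑-cong (B i) (λ {j} j<Bi → scaled-linearization x M (w i j) i j (i+j<M i<N j<Bi))) ⟩
  ∑ N (λ i → ∑ (B i) (λ j → ∑ M (λ l → T i j l)))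
    ≡⟨ ∑-cong′ N (λ i → ∑-comm (B i) M (T i)) ⟩
  ∑ N (λ i → ∑ M (λ l → ∑ (B i) (λ j → T i j l)))
    ≡⟨ ∑-comm N M (λ i l → ∑ (B i) (λ j → T i j l)) ⟩
  ∑ M (λ l → ∑ N (λ i → ∑ (B i) (λ j → T i j l)))
    ≡⟨ ∑-cong′ M collect ⟩
  ∑ M (λ l → ℕ→ℚ (bilinearCoeff N B w l) * basis x l)
    ∎
  where
  c : ℕ → ℕ → ℕ → ℕ
  c i j l = w i j *ℕ linCoeff i j l
  T : ℕ → ℕ → ℕ → ℚ
  T i j l = ℕ→ℚ (c i j l) * basis x l
  collect : ∀ l → ∑ N (λ i → ∑ (B i) (λ j → T i j l)) ≡ ℕ→ℚ (bilinearCoeff N B w l) * basis x l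
  collect l = begin
    ∑ N (λ i → ∑ (B i) (λ j → T i j l))
      ≡⟨ ∑-cong′ N (λ i → *-distribʳ-∑ (B i) (basis x l) (λ j → ℕ→ℚ (c i j l))) ⟨
    ∑ N (λ i → ∑ (B i) (λ j → ℕ→ℚ (c i j l)) * basis x l)
      ≡⟨ *-distribʳ-∑ N (basis x l) (λ i → ∑ (B i) (λ j → ℕ→ℚ (c i j l))) ⟨
    ∑ N (λ i → ∑ (B i) (λ j → ℕ→ℚ (c i j l))) * basis x l
      ≡⟨ cong (_* basis x l) (∑-cong′ N (λ i → ℕ→ℚ-∑ (B i) (λ j → c i j l))) ⟨
    ∑ N (λ i → ℕ→ℚ (ℕ∑.∑ (B i) (λ j → c i j l))) * basis x l
      ≡⟨ cong (_* basis x l) (ℕ→ℚ-∑ N (λ i → ℕ∑.∑ (B i) (λ j → c i j l))) ⟨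
    ℕ→ℚ (bilinearCoeff N B w l) * basis x l
      ∎

sumTo-∑ : ∀ n f → sumTo n f ≡ ∑ (suc n) f
sumTo-∑ zero    f = sym (ℚ.+-identityˡ (f 0))
sumTo-∑ (suc n) f = cong (_+ f (suc n)) (sumTo-∑ n f)

s-basis : ∀ n x → s n x ≡ ∑ (suc n) (λ i → choose n i * basis x i)
s-basis n x = trans (sumTo-∑ n _) (∑-cong′ (suc n) (λ i → ℚ.*-assoc (choose n i) (binom x i) (binom (x + ℕ→ℚ i) i)))

square-expansion : ∀ n x →
  s n x * s n x ≡ ∑ (suc n) (λ i → ∑ (suc n) (λ j → ℕ→ℚ (squareWeight n i j) * (basis x i * basis x j)))
square-expansion n x = begin
  s n x * s n x
    ≡⟨ cong₂ _*_ (s-basis n x) (s-basis n x) ⟩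
  ∑ (suc n) (λ i → choose n i * basis x i) * ∑ (suc n) (λ j → choose n j * basis x j)
    ≡⟨ ∑-*-∑ (suc n) (suc n) _ _ ⟩
  ∑ (suc n) (λ i → ∑ (suc n) (λ j → (choose n i * basis x i) * (choose n j * basis x j)))
    ≡⟨ ∑-cong′ (suc n) (λ i → ∑-cong′ (suc n) (regroup i)) ⟩
  ∑ (suc n) (λ i → ∑ (suc n) (λ j → ℕ→ℚ (squareWeight n i j) * (basis x i * basis x j))) ∎
  where
  regroup : ∀ i j → (choose n i * basis x i) * (choose n j * basis x j) ≡ ℕ→ℚ (squareWeight n i j) * (basis x i * basis x j)
  regroup i j = trans (interchange (choose n i) (basis x i) (choose n j) (basis x j))
                      (cong (_* (basis x i * basis x j)) (sym (ℕ→ℚ-* (n C i) (n C j))))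
    where
    interchange : ∀ a b c d → (a * b) * (c * d) ≡ (a * c) * (b * d)
    interchange = solve-∀ ℚ-ring

rhs-expansion : ∀ n x →
  sumTo n (λ k → choose (n +ℕ k) (2 *ℕ k) * binom x k * binom (x + ℕ→ℚ k) k
                  * sumTo k (λ j → choose (2 *ℕ k) (j +ℕ k) * binom x j * binom (x + ℕ→ℚ j) j))
    ≡ ∑ (suc n) (λ k → ∑ (suc k) (λ j → ℕ→ℚ (rhsWeight n k j) * (basis x k * basis x j)))
rhs-expansion n x = trans (sumTo-∑ n _) (∑-cong′ (suc n) row)
  where
  row : ∀ k → choose (n +ℕ k) (2 *ℕ k) * binom x k * binom (x + ℕ→ℚ k) k
                * sumTo k (λ j → choose (2 *ℕ k) (j +ℕ k) * binom x j * binom (x + ℕ→ℚ j) j)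
              ≡ ∑ (suc k) (λ j → ℕ→ℚ (rhsWeight n k j) * (basis x k * basis x j))
  row k = begin
    b * binom x k * binom (x + ℕ→ℚ k) k * sumTo k (λ j → d j * binom x j * binom (x + ℕ→ℚ j) j)
      ≡⟨ cong₂ _*_ (ℚ.*-assoc b (binom x k) (binom (x + ℕ→ℚ k) k))
                   (trans (sumTo-∑ k _) (∑-cong′ (suc k) (λ j → ℚ.*-assoc (d j) (binom x j) (binom (x + ℕ→ℚ j) j)))) ⟩
    (b * basis x k) * ∑ (suc k) (λ j → d j * basis x j)
      ≡⟨ *-distribˡ-∑ (suc k) (b * basis x k) (λ j → d j * basis x j) ⟩
    ∑ (suc k) (λ j → (b * basis x k) * (d j * basis x j))
      ≡⟨ ∑-cong′ (suc k) (λ j → trans (interchange b (basis x k) (d j) (basis x j)) (cong (_* (basis x k * basis x j)) (weight j))) ⟩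
    ∑ (suc k) (λ j → ℕ→ℚ (rhsWeight n k j) * (basis x k * basis x j))
      ∎
    where
    b = choose (n +ℕ k) (2 *ℕ k)
    d : ℕ → ℚ
    d j = choose (2 *ℕ k) (j +ℕ k)
    weight : ∀ j → b * d j ≡ ℕ→ℚ (rhsWeight n k j)
    weight j = trans (sym (ℕ→ℚ-* ((n +ℕ k) C (2 *ℕ k)) ((2 *ℕ k) C (j +ℕ k))))
                     (cong (λ m → ℕ→ℚ (((n +ℕ k) C m) *ℕ (m C (j +ℕ k)))) (cong (k +ℕ_) (ℕ.+-identityʳ k)))
    interchange : ∀ a b c e → (a * b) * (c * e) ≡ (a * c) * (b * e)
    interchange = solve-∀ ℚ-ring

-- The two coefficients are the two sides of basis-convolution at x = n, where basis takes the values basisℕ n k.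
coefficients-agree : ∀ n l →
  ℕ→ℚ (bilinearCoeff (suc n) (λ _ → suc n) (squareWeight n) l) ≡ ℕ→ℚ (bilinearCoeff (suc n) suc (rhsWeight n) l)
coefficients-agree n l = begin
  ℕ→ℚ (bilinearCoeff (suc n) (λ _ → suc n) (squareWeight n) l)
    ≡⟨ cong ℕ→ℚ (bilinearCoeff-square n l) ⟩
  ℕ→ℚ (ℕ∑.∑ (suc l) (λ t → basisℕ n t *ℕ basisℕ n (l ∸ t)))
    ≡⟨ ℕ→ℚ-∑ (suc l) (λ t → basisℕ n t *ℕ basisℕ n (l ∸ t)) ⟩
  ∑ (suc l) (λ t → ℕ→ℚ (basisℕ n t *ℕ basisℕ n (l ∸ t)))
    ≡⟨ ∑-cong′ (suc l) (λ t → trans (ℕ→ℚ-* (basisℕ n t) (basisℕ n (l ∸ t)))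
                                    (sym (cong₂ _*_ (basis-ℕ n t) (basis-ℕ n (l ∸ t))))) ⟩
  ∑ (suc l) (λ t → basis (ℕ→ℚ n) t * basis (ℕ→ℚ n) (l ∸ t))
    ≡⟨ basis-convolution (ℕ→ℚ n) l ⟩
  ∑ (suc l) (λ k → ℕ→ℚ (c k) * basis (ℕ→ℚ n) k)
    ≡⟨ ∑-cong′ (suc l) (λ k → trans (cong (ℕ→ℚ (c k) *_) (basis-ℕ n k)) (sym (ℕ→ℚ-* (c k) (basisℕ n k)))) ⟩
  ∑ (suc l) (λ k → ℕ→ℚ (c k *ℕ basisℕ n k))
    ≡⟨ ℕ→ℚ-∑ (suc l) (λ k → c k *ℕ basisℕ n k) ⟨
  ℕ→ℚ (ℕ∑.∑ (suc l) (λ k → c k *ℕ basisℕ n k))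
    ≡⟨ cong ℕ→ℚ (bilinearCoeff-rhs n l) ⟨
  ℕ→ℚ (bilinearCoeff (suc n) suc (rhsWeight n) l)
    ∎
  where
  c : ℕ → ℕ
  c k = (l C k) *ℕ ((k +ℕ k) C l)

lemma3p2 : (n : ℕ) (x : ℚ) →
    s n x * s n x
    ≡ sumTo n (λ k → choose (n +ℕ k) (2 *ℕ k) * binom x k * binom (x + ℕ→ℚ k) k
    * sumTo k (λ j → choose (2 *ℕ k) (j +ℕ k) * binom x j * binom (x + ℕ→ℚ j) j))
lemma3p2 n x = begin
  s n x * s n x
    ≡⟨ square-expansion n x ⟩
  ∑ (suc n) (λ i → ∑ (suc n) (λ j → ℕ→ℚ (squareWeight n i j) * (basis x i * basis x j)))
    ≡⟨ bilinear-expansion x (suc n) (λ _ → suc n) M (squareWeight n) square-bound ⟩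
  ∑ M (λ l → ℕ→ℚ (bilinearCoeff (suc n) (λ _ → suc n) (squareWeight n) l) * basis x l)
    ≡⟨ ∑-cong′ M (λ l → cong (_* basis x l) (coefficients-agree n l)) ⟩
  ∑ M (λ l → ℕ→ℚ (bilinearCoeff (suc n) suc (rhsWeight n) l) * basis x l)
    ≡⟨ bilinear-expansion x (suc n) suc M (rhsWeight n) rhs-bound ⟨
  ∑ (suc n) (λ k → ∑ (suc k) (λ j → ℕ→ℚ (rhsWeight n k j) * (basis x k * basis x j)))
    ≡⟨ rhs-expansion n x ⟨
  sumTo n (λ k → choose (n +ℕ k) (2 *ℕ k) * binom x k * binom (x + ℕ→ℚ k) k
    * sumTo k (λ j → choose (2 *ℕ k) (j +ℕ k) * binom x j * binom (x + ℕ→ℚ j) j))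
    ∎
  where
  M = suc (n +ℕ n)
  square-bound : ∀ {i j} → i < suc n → j < suc n → i +ℕ j < M
  square-bound i<1+n j<1+n = ℕ.s≤s (ℕ.+-mono-≤ (ℕ.≤-pred i<1+n) (ℕ.≤-pred j<1+n))
  rhs-bound : ∀ {k j} → k < suc n → j < suc k → k +ℕ j < M
  rhs-bound k<1+n j<1+k = ℕ.s≤s (ℕ.+-mono-≤ (ℕ.≤-pred k<1+n) (ℕ.≤-trans (ℕ.≤-pred j<1+k) (ℕ.≤-pred k<1+n)))
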